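{- Let $m\geq2$ be an integer. Then for all integers $N\geq m^2$, $$\sum_{a=0}^{m-1}\mathbb{E}\left(\left(\widetilde{\Phi}_{\mathrm{rand}}(N;m,a)-\frac{1}{m}\right)^2\right)\ll\frac{m^2}{N},$$ with an absolute implied constant.
   Context: Let $\widetilde{X}_1,\widetilde{X}_2,\dots$ be independent random variables each taking the values $0$ and $1$ with probability $1/2$, and $\widetilde{S}_k=\widetilde{X}_1+\cdots+\widetilde{X}_k$. Define $\widetilde{\Phi}_{\mathrm{rand}}(N;m,a)=\frac{1}{N}\left|\{1\leq j\leq N:\widetilde{S}_j\equiv a\bmod m\}\right|$. $\mathbb{E}$ denotes expectation. -}

module Defs where

open import Data.Bool using (Bool; true; false; if_then_else_)
open import Data.Nat as ℕ using (ℕ; zero; suc; _%_; _^_; NonZero)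
open import Data.Nat.Properties using (m^n≢0)
open import Data.List using (List; []; _∷_; map; _++_; upTo; take; filter; length; foldr)
open import Data.Integer using (+_)
open import Data.Rational using (ℚ; 0ℚ; _+_; _-_; _*_; _/_)
open import Relation.Nullary.Decidable using (⌊_⌋)

-- All 2^n outcomes (X̃₁,…,X̃ₙ) ∈ {0,1}^n, true = 1, false = 0 (each equally likely).
allBits : ℕ → List (List Bool)
allBits zero = [] ∷ []
allBits (suc n) = map (true ∷_) (allBits n) ++ map (false ∷_) (allBits n)

ones : List Bool → ℕ
ones [] = 0
ones (true ∷ bs) = suc (ones bs)
ones (false ∷ bs) = ones bs

partialSum : List Bool → ℕ → ℕ
partialSum bs j = ones (take j bs)

hitCount : (m : ℕ) .{{_ : NonZero m}} → ℕ → (N : ℕ) → List Bool → ℕ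
hitCount m a N bs =
  length (filter (λ j → (partialSum bs j % m) ℕ.≟ (a % m)) (map suc (upTo N)))

Φrand : (N : ℕ) .{{_ : NonZero N}} → (m : ℕ) .{{_ : NonZero m}} → ℕ → List Bool → ℚ
Φrand N m a bs = (+ hitCount m a N bs) / N

sumℚ : List ℚ → ℚ
sumℚ = foldr _+_ 0ℚ

𝔼 : (N : ℕ) → (List Bool → ℚ) → ℚ
𝔼 N f = sumℚ (map f (allBits N)) * _/_ (+ 1) (2 ^ N) {{m^n≢0 2 N}}

varianceSum : (N : ℕ) .{{_ : NonZero N}} → (m : ℕ) .{{_ : NonZero m}} → ℚ
varianceSum N m =
  sumℚ (map (λ a → 𝔼 N (λ bs → let d = Φrand N m a bs - (+ 1) / m in d * d)) (upTo m))

-- Let h_a count the j ≤ N with S̃_j ≡ a (mod m). Since Σ_a h_a = N, the variance sum is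
-- E Σ_a (m h_a − N)² / (m N)² = (m² E Σ_a h_a² − m N²) / (m N)², so it suffices to show
-- m · E Σ_a h_a² ≤ N² + 33 m³ N. Peeling off the first step, E Σ_a h_a² grows by the expected
-- number of later returns of the walk to its current class, Σ_k 2^(−k) P_k, where P_k(s) counts
-- the bit strings of length k carrying s to a fixed class. The deviation m P_k − 2^k is measured
-- by the energy E f = m Σ f² − (Σ f)² of m-periodic functions: the step f ↦ f + f(· + 1)
-- multiplies it by 4 and subtracts m times the Dirichlet energy, which a discrete Poincaré
-- inequality bounds below by E / m³, so 4^(−k) E(P_k) decays like (1 − 1/(4m²))^k. Writing
-- P_{2k} as a convolution of two walks of length k, Cauchy–Schwarz bounds the deviation at
-- time 2k by the energies at time k, and the geometric series sums to O(m³).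

module Submission where

open import Data.Nat using (ℕ)

module IntegerFacts where

  open import Data.Nat as ℕ using (ℕ; zero; suc)
  open import Data.Integer as ℤ using (ℤ; +_; _+_; _*_; _-_; _≤_; _^_; 0ℤ)
  import Data.Integer.Properties as ℤP
  open import Data.Integer.Tactic.RingSolver using (solve-∀)
  open import Relation.Binary.PropositionalEquality

  sq : ℤ → ℤ
  sq x = x * x

  sq-nonneg : ∀ x → 0ℤ ≤ sq x
  sq-nonneg (+ zero) = ℤ.+≤+ ℕ.z≤n
  sq-nonneg (+ suc n) = ℤ.+≤+ ℕ.z≤n
  sq-nonneg ℤ.-[1+ n ] = ℤ.+≤+ ℕ.z≤n

  +-nonneg : ∀ {x y} → 0ℤ ≤ x → 0ℤ ≤ y → 0ℤ ≤ x + y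
  +-nonneg = ℤP.+-mono-≤

  *-monoˡ-≤-nonneg : ∀ {c x y} → 0ℤ ≤ c → x ≤ y → c * x ≤ c * y
  *-monoˡ-≤-nonneg {c} 0≤c = ℤP.*-monoˡ-≤-nonNeg c {{ℤ.nonNegative 0≤c}}

  *-monoʳ-≤-nonneg : ∀ {c x y} → 0ℤ ≤ c → x ≤ y → x * c ≤ y * c
  *-monoʳ-≤-nonneg {c} 0≤c = ℤP.*-monoʳ-≤-nonNeg c {{ℤ.nonNegative 0≤c}}

  *-nonneg : ∀ {x y} → 0ℤ ≤ x → 0ℤ ≤ y → 0ℤ ≤ x * y
  *-nonneg {x} {y} 0≤x 0≤y = subst (_≤ x * y) (ℤP.*-zeroʳ x) (*-monoˡ-≤-nonneg 0≤x 0≤y)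

  ℕ-nonneg : ∀ n → 0ℤ ≤ + n
  ℕ-nonneg n = ℤ.+≤+ ℕ.z≤n

  ≤-by-nonneg-difference : ∀ {x y} d → y - x ≡ d → 0ℤ ≤ d → x ≤ y
  ≤-by-nonneg-difference d refl = ℤP.0≤i-j⇒j≤i

  ≤-2* : ∀ {x} → 0ℤ ≤ x → x ≤ + 2 * x
  ≤-2* {x} = ≤-by-nonneg-difference x (difference x)
    where
    difference : ∀ x → + 2 * x - x ≡ x
    difference = solve-∀

  pos-^ : ∀ a k → + (a ℕ.^ k) ≡ (+ a) ^ k
  pos-^ a zero = refl
  pos-^ a (suc k) = trans (ℤP.pos-* a (a ℕ.^ k)) (cong (+ a *_) (pos-^ a k))

  2*-≤-sq+sq : ∀ u v → + 2 * (u * v) ≤ sq u + sq v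
  2*-≤-sq+sq u v = ≤-by-nonneg-difference (sq (u - v)) (identity u v) (sq-nonneg (u - v))
    where
    identity : ∀ u v → u * u + v * v - + 2 * (u * v) ≡ (u - v) * (u - v)
    identity = solve-∀

  -- The inductive step of Cauchy–Schwarz for (Σ δᵢ)² ≤ n · Σ δᵢ².
  sq-+-≤ : ∀ k s δ P → sq s ≤ + suc k * P → sq (s + δ) ≤ + suc (suc k) * (P + sq δ)
  sq-+-≤ k s δ P s²≤kP =
    ≤-by-nonneg-difference _ (split K s δ P) (+-nonneg slack cross)
    where
    K = + suc k
    slack : 0ℤ ≤ K * P - sq s
    slack = ℤP.i≤j⇒0≤j-i s²≤kP
    -- K·(P + Kδ² − 2sδ) is the sum of the slack and (s − Kδ)², hence nonnegative.
    cross : 0ℤ ≤ P + K * sq δ - + 2 * s * δ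
    cross = ℤP.*-cancelˡ-≤-pos 0ℤ _ K
      (subst₂ _≤_ (sym (ℤP.*-zeroʳ K)) (sym (scaled K P s δ)) (+-nonneg slack (sq-nonneg (s - K * δ))))
      where
      scaled : ∀ K P s δ → K * (P + K * (δ * δ) - + 2 * s * δ) ≡ (K * P - s * s) + (s - K * δ) * (s - K * δ)
      scaled = solve-∀
    split : ∀ K s δ P → (+ 1 + K) * (P + δ * δ) - (s + δ) * (s + δ) ≡ (K * P - s * s) + (P + K * (δ * δ) - + 2 * s * δ)
    split = solve-∀

module Sums where

  open import Data.Nat as ℕ using (ℕ; zero; suc)
  open import Data.Integer using (ℤ; +_; _+_; _*_; _-_; _≤_; 0ℤ)
  import Data.Integer.Properties as ℤP
  open import Data.Integer.Tactic.RingSolver using (solve-∀)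
  open import Relation.Binary.PropositionalEquality
  open import Function using (_∘_)
  open IntegerFacts

  sumTo : ℕ → (ℕ → ℤ) → ℤ
  sumTo zero f = 0ℤ
  sumTo (suc n) f = f 0 + sumTo n (f ∘ suc)

  sumTo-cong : ∀ n {f g : ℕ → ℤ} → (∀ i → i ℕ.< n → f i ≡ g i) → sumTo n f ≡ sumTo n g
  sumTo-cong zero eq = refl
  sumTo-cong (suc n) eq = cong₂ _+_ (eq 0 (ℕ.s≤s ℕ.z≤n)) (sumTo-cong n (λ i i<n → eq (suc i) (ℕ.s≤s i<n)))

  sumTo-ext : ∀ n {f g : ℕ → ℤ} → (∀ i → f i ≡ g i) → sumTo n f ≡ sumTo n g
  sumTo-ext n eq = sumTo-cong n (λ i _ → eq i)

  sumTo-+ : ∀ n (f g : ℕ → ℤ) → sumTo n (λ i → f i + g i) ≡ sumTo n f + sumTo n g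
  sumTo-+ zero f g = refl
  sumTo-+ (suc n) f g = trans (cong (_+_ (f 0 + g 0)) (sumTo-+ n (f ∘ suc) (g ∘ suc))) (interchange (f 0) (g 0) _ _)
    where
    interchange : ∀ a b c d → (a + b) + (c + d) ≡ (a + c) + (b + d)
    interchange = solve-∀

  sumTo-* : ∀ n c (f : ℕ → ℤ) → sumTo n (λ i → c * f i) ≡ c * sumTo n f
  sumTo-* zero c f = sym (ℤP.*-zeroʳ c)
  sumTo-* (suc n) c f = trans (cong (_+_ (c * f 0)) (sumTo-* n c (f ∘ suc))) (sym (ℤP.*-distribˡ-+ c (f 0) _))

  sumTo-const : ∀ n c → sumTo n (λ _ → c) ≡ + n * c
  sumTo-const zero c = sym (ℤP.*-zeroˡ c)
  sumTo-const (suc n) c = trans (cong (_+_ c) (sumTo-const n c)) (sym (ℤP.suc-* (+ n) c))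

  sumTo-zero : ∀ n → sumTo n (λ _ → 0ℤ) ≡ 0ℤ
  sumTo-zero n = trans (sumTo-const n 0ℤ) (ℤP.*-zeroʳ (+ n))

  sumTo-suc : ∀ n (f : ℕ → ℤ) → sumTo (suc n) f ≡ sumTo n f + f n
  sumTo-suc zero f = ℤP.+-comm (f 0) 0ℤ
  sumTo-suc (suc n) f = trans (cong (_+_ (f 0)) (sumTo-suc n (f ∘ suc))) (sym (ℤP.+-assoc (f 0) _ _))

  sumTo-mono-≤ : ∀ n {f g : ℕ → ℤ} → (∀ i → i ℕ.< n → f i ≤ g i) → sumTo n f ≤ sumTo n g
  sumTo-mono-≤ zero f≤g = ℤP.≤-refl
  sumTo-mono-≤ (suc n) f≤g = ℤP.+-mono-≤ (f≤g 0 (ℕ.s≤s ℕ.z≤n)) (sumTo-mono-≤ n (λ i i<n → f≤g (suc i) (ℕ.s≤s i<n)))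

  sumTo-nonneg : ∀ n {f : ℕ → ℤ} → (∀ i → 0ℤ ≤ f i) → 0ℤ ≤ sumTo n f
  sumTo-nonneg n {f} 0≤f = subst (_≤ sumTo n f) (sumTo-zero n) (sumTo-mono-≤ n (λ i _ → 0≤f i))

  sumTo-monoˡ-≤ : ∀ {k n} {f : ℕ → ℤ} → k ℕ.≤ n → (∀ i → 0ℤ ≤ f i) → sumTo k f ≤ sumTo n f
  sumTo-monoˡ-≤ {zero} {n} ℕ.z≤n 0≤f = sumTo-nonneg n 0≤f
  sumTo-monoˡ-≤ {suc k} {suc n} {f} (ℕ.s≤s k≤n) 0≤f = ℤP.+-monoʳ-≤ (f 0) (sumTo-monoˡ-≤ k≤n (λ i → 0≤f (suc i)))

  sumTo-swap : ∀ n k (f : ℕ → ℕ → ℤ) → sumTo n (λ a → sumTo k (f a)) ≡ sumTo k (λ j → sumTo n (λ a → f a j))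
  sumTo-swap zero k f = sym (sumTo-zero k)
  sumTo-swap (suc n) k f = trans (cong (_+_ (sumTo k (f 0))) (sumTo-swap n k (f ∘ suc)))
    (sym (sumTo-+ k (f 0) (λ j → sumTo n (λ a → f (suc a) j))))

  sumTo-quadratic : ∀ n (α β γ : ℤ) (f : ℕ → ℤ) →
    sumTo n (λ b → α * sq (f b) + β * f b + γ) ≡ α * sumTo n (λ b → sq (f b)) + β * sumTo n f + + n * γ
  sumTo-quadratic n α β γ f = trans (sumTo-+ n (λ b → α * sq (f b) + β * f b) (λ _ → γ))
    (cong₂ _+_ (trans (sumTo-+ n (λ b → α * sq (f b)) (λ b → β * f b)) (cong₂ _+_ (sumTo-* n α _) (sumTo-* n β f)))
               (sumTo-const n γ))

  sumTo-bilinear : ∀ n (α β γ δ : ℤ) (f g : ℕ → ℤ) →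
    sumTo n (λ b → (α * f b + β) * (γ * g b + δ)) ≡
    (α * γ) * sumTo n (λ b → f b * g b) + (α * δ) * sumTo n f + (β * γ) * sumTo n g + + n * (β * δ)
  sumTo-bilinear n α β γ δ f g = begin
      sumTo n (λ b → (α * f b + β) * (γ * g b + δ))
    ≡⟨ sumTo-ext n (λ b → expand α β γ δ (f b) (g b)) ⟩
      sumTo n (λ b → (α * γ) * (f b * g b) + (α * δ) * f b + (β * γ) * g b + β * δ)
    ≡⟨ sumTo-+ n _ (λ _ → β * δ) ⟩
      sumTo n (λ b → (α * γ) * (f b * g b) + (α * δ) * f b + (β * γ) * g b) + sumTo n (λ _ → β * δ)
    ≡⟨ cong₂ _+_ (trans (sumTo-+ n _ (λ b → (β * γ) * g b)) (cong₂ _+_ (trans (sumTo-+ n _ (λ b → (α * δ) * f b))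
         (cong₂ _+_ (sumTo-* n (α * γ) _) (sumTo-* n (α * δ) f))) (sumTo-* n (β * γ) g))) (sumTo-const n (β * δ)) ⟩
      (α * γ) * sumTo n (λ b → f b * g b) + (α * δ) * sumTo n f + (β * γ) * sumTo n g + + n * (β * δ)
    ∎
    where
    open ≡-Reasoning
    expand : ∀ α β γ δ x y → (α * x + β) * (γ * y + δ) ≡ (α * γ) * (x * y) + (α * δ) * x + (β * γ) * y + β * δ
    expand = solve-∀

  sq-telescope-≤ : ∀ (f : ℕ → ℤ) b → sq (f b - f 0) ≤ + suc b * sumTo b (λ i → sq (f (suc i) - f i))
  sq-telescope-≤ f zero = subst (λ z → sq z ≤ + 1 * 0ℤ) (sym (ℤP.+-inverseʳ (f 0))) ℤP.≤-refl
  sq-telescope-≤ f (suc b) = subst₂ _≤_ (cong sq (telescope (f b) (f 0) (f (suc b))))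
    (cong (+ suc (suc b) *_) (sym (sumTo-suc b increment²)))
    (sq-+-≤ b (f b - f 0) (f (suc b) - f b) (sumTo b increment²) (sq-telescope-≤ f b))
    where
    increment² = λ i → sq (f (suc i) - f i)
    telescope : ∀ x y z → (x - y) + (z - x) ≡ z - y
    telescope = solve-∀

module PeriodicEnergy (m₁ : ℕ) where

  open import Data.Nat as ℕ using (ℕ; zero; suc)
  import Data.Nat.Properties as ℕP
  open import Data.Integer as ℤ using (ℤ; +_; _+_; _*_; _-_; -_; _≤_; 0ℤ)
  import Data.Integer.Properties as ℤP
  open import Data.Integer.Tactic.RingSolver using (solve-∀)
  open import Algebra.Properties.AbelianGroup ℤP.+-0-abelianGroup using (∙-cancelˡ)
  open import Algebra.Properties.CommutativeSemigroup ℕP.+-commutativeSemigroup using (xy∙z≈xz∙y)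
  open import Relation.Binary.PropositionalEquality
  open import Function using (_∘_)
  open IntegerFacts
  open Sums

  m : ℕ
  m = suc m₁

  M : ℤ
  M = + m

  Periodic : (ℕ → ℤ) → Set
  Periodic f = ∀ i → f (i ℕ.+ m) ≡ f i

  Σ : (ℕ → ℤ) → ℤ
  Σ = sumTo m

  Σsq : (ℕ → ℤ) → ℤ
  Σsq f = Σ (λ b → sq (f b))

  Σ-rotate : ∀ {f} → Periodic f → Σ (f ∘ suc) ≡ Σ f
  Σ-rotate {f} per = ∙-cancelˡ (f 0) _ _ (begin
      f 0 + Σ (f ∘ suc)   ≡⟨ sumTo-suc m f ⟩
      Σ f + f m           ≡⟨ cong (_+_ (Σ f)) (per 0) ⟩
      Σ f + f 0           ≡⟨ ℤP.+-comm (Σ f) (f 0) ⟩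
      f 0 + Σ f           ∎)
    where open ≡-Reasoning

  Σ-shiftˡ : ∀ {f} → Periodic f → ∀ t → Σ (λ b → f (t ℕ.+ b)) ≡ Σ f
  Σ-shiftˡ per zero = refl
  Σ-shiftˡ {f} per (suc t) = trans (sumTo-ext m (λ b → cong f (sym (ℕP.+-suc t b))))
    (trans (Σ-rotate (λ i → trans (cong f (sym (ℕP.+-assoc t i m))) (per (t ℕ.+ i)))) (Σ-shiftˡ per t))

  Σ-shiftʳ : ∀ {f} → Periodic f → ∀ t → Σ (λ b → f (b ℕ.+ t)) ≡ Σ f
  Σ-shiftʳ {f} per t = trans (sumTo-ext m (λ b → cong f (ℕP.+-comm b t))) (Σ-shiftˡ per t)

  Periodic-sq : ∀ {f} → Periodic f → Periodic (λ b → sq (f b))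
  Periodic-sq per i = cong sq (per i)

  -- m² times the variance of f over one period.
  energy : (ℕ → ℤ) → ℤ
  energy f = M * Σsq f - sq (Σ f)

  energy-cong : ∀ {f g : ℕ → ℤ} → (∀ b → f b ≡ g b) → energy f ≡ energy g
  energy-cong eq = cong₂ (λ u v → M * u - sq v) (sumTo-ext m (λ b → cong sq (eq b))) (sumTo-ext m eq)

  Σ-sq-deviation : ∀ (f : ℕ → ℤ) → Σ (λ b → sq (M * f b - Σ f)) ≡ M * energy f
  Σ-sq-deviation f = trans (sumTo-ext m (λ b → expand M (Σ f) (f b)))
    (trans (sumTo-quadratic m (M * M) (- (+ 2 * M * Σ f)) (Σ f * Σ f) f) (collect M (Σsq f) (Σ f)))
    where
    expand : ∀ M X y → (M * y - X) * (M * y - X) ≡ (M * M) * (y * y) + - (+ 2 * M * X) * y + X * X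
    expand = solve-∀
    collect : ∀ M S X → (M * M) * S + - (+ 2 * M * X) * X + M * (X * X) ≡ M * (M * S - X * X)
    collect = solve-∀

  M*-cancel-≤ : ∀ {x y} → M * x ≤ M * y → x ≤ y
  M*-cancel-≤ {x} {y} = ℤP.*-cancelˡ-≤-pos x y M

  energy-nonneg : ∀ (f : ℕ → ℤ) → 0ℤ ≤ energy f
  energy-nonneg f = M*-cancel-≤ (subst₂ _≤_ (sym (ℤP.*-zeroʳ M)) (Σ-sq-deviation f)
    (sumTo-nonneg m (λ b → sq-nonneg (M * f b - Σ f))))

  energy-≤-Σ-sq-from : ∀ (f : ℕ → ℤ) a → energy f ≤ M * Σ (λ b → sq (f b - a))
  energy-≤-Σ-sq-from f a = ≤-by-nonneg-difference (sq (M * a - Σ f)) difference (sq-nonneg (M * a - Σ f))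
    where
    expand : ∀ y a → (y - a) * (y - a) ≡ + 1 * (y * y) + - (+ 2 * a) * y + a * a
    expand = solve-∀
    moment : Σ (λ b → sq (f b - a)) ≡ + 1 * Σsq f + - (+ 2 * a) * Σ f + M * (a * a)
    moment = trans (sumTo-ext m (λ b → expand (f b) a)) (sumTo-quadratic m (+ 1) (- (+ 2 * a)) (a * a) f)
    collect : ∀ M S X a → M * (+ 1 * S + - (+ 2 * a) * X + M * (a * a)) - (M * S - X * X) ≡ (M * a - X) * (M * a - X)
    collect = solve-∀
    difference : M * Σ (λ b → sq (f b - a)) - energy f ≡ sq (M * a - Σ f)
    difference = trans (cong (λ z → M * z - energy f) moment) (collect M (Σsq f) (Σ f) a)

  dirichlet : (ℕ → ℤ) → ℤ
  dirichlet f = Σ (λ i → sq (f (suc i) - f i))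

  sq-deviation-≤-dirichlet : ∀ (f : ℕ → ℤ) b → b ℕ.< m → sq (f b - f 0) ≤ M * dirichlet f
  sq-deviation-≤-dirichlet f b b<m = ℤP.≤-trans (sq-telescope-≤ f b)
    (ℤP.≤-trans (*-monoʳ-≤-nonneg (sumTo-nonneg b increment²-nonneg) (ℤ.+≤+ b<m))
                (*-monoˡ-≤-nonneg (ℕ-nonneg m) (sumTo-monoˡ-≤ (ℕP.<⇒≤ b<m) increment²-nonneg)))
    where
    increment²-nonneg : ∀ i → 0ℤ ≤ sq (f (suc i) - f i)
    increment²-nonneg i = sq-nonneg (f (suc i) - f i)

  energy-≤-dirichlet : ∀ (f : ℕ → ℤ) → energy f ≤ M * (M * (M * dirichlet f))
  energy-≤-dirichlet f = ℤP.≤-trans (energy-≤-Σ-sq-from f (f 0)) (*-monoˡ-≤-nonneg (ℕ-nonneg m)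
    (subst (Σ (λ b → sq (f b - f 0)) ≤_) (sumTo-const m (M * dirichlet f))
      (sumTo-mono-≤ m (sq-deviation-≤-dirichlet f))))

  step : ℕ → (ℕ → ℤ) → ℕ → ℤ
  step t f s = f s + f (s ℕ.+ t)

  shiftDistance : (ℕ → ℤ) → ℕ → ℤ
  shiftDistance f t = Σ (λ b → sq (f b - f (b ℕ.+ t)))

  Periodic-shift : ∀ {f} → Periodic f → ∀ t → Periodic (λ b → f (b ℕ.+ t))
  Periodic-shift {f} per t i = trans (cong f (xy∙z≈xz∙y i m t)) (per (i ℕ.+ t))

  Periodic-step : ∀ {f} t → Periodic f → Periodic (step t f)
  Periodic-step t per i = cong₂ _+_ (per i) (Periodic-shift per t i)

  Σ-step : ∀ {f} → Periodic f → ∀ t → Σ (step t f) ≡ + 2 * Σ f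
  Σ-step {f} per t = trans (sumTo-+ m f (λ b → f (b ℕ.+ t)))
    (trans (cong (_+_ (Σ f)) (Σ-shiftʳ per t)) (double (Σ f)))
    where
    double : ∀ x → x + x ≡ + 2 * x
    double = solve-∀

  Σsq-step : ∀ {f} → Periodic f → ∀ t → Σsq (step t f) ≡ + 4 * Σsq f - shiftDistance f t
  Σsq-step {f} per t = trans (sym (plus-minus (Σsq (step t f)) (shiftDistance f t))) (cong (_- shiftDistance f t) (begin
      Σsq (step t f) + shiftDistance f t
    ≡⟨ sym (sumTo-+ m (λ b → sq (step t f b)) (λ b → sq (f b - f (b ℕ.+ t)))) ⟩
      Σ (λ b → sq (step t f b) + sq (f b - f (b ℕ.+ t)))
    ≡⟨ sumTo-ext m (λ b → parallelogram (f b) (f (b ℕ.+ t))) ⟩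
      Σ (λ b → + 2 * sq (f b) + + 2 * sq (f (b ℕ.+ t)))
    ≡⟨ sumTo-+ m (λ b → + 2 * sq (f b)) (λ b → + 2 * sq (f (b ℕ.+ t))) ⟩
      Σ (λ b → + 2 * sq (f b)) + Σ (λ b → + 2 * sq (f (b ℕ.+ t)))
    ≡⟨ cong₂ _+_ (sumTo-* m (+ 2) (λ b → sq (f b)))
                 (trans (sumTo-* m (+ 2) (λ b → sq (f (b ℕ.+ t)))) (cong (+ 2 *_) (Σ-shiftʳ (Periodic-sq per) t))) ⟩
      + 2 * Σsq f + + 2 * Σsq f
    ≡⟨ double (Σsq f) ⟩
      + 4 * Σsq f
    ∎))
    where
    open ≡-Reasoning
    plus-minus : ∀ a b → (a + b) - b ≡ a
    plus-minus = solve-∀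
    parallelogram : ∀ a c → (a + c) * (a + c) + (a - c) * (a - c) ≡ + 2 * (a * a) + + 2 * (c * c)
    parallelogram = solve-∀
    double : ∀ x → + 2 * x + + 2 * x ≡ + 4 * x
    double = solve-∀

  energy-step : ∀ {f} → Periodic f → ∀ t → energy (step t f) ≡ + 4 * energy f - M * shiftDistance f t
  energy-step {f} per t = trans (cong₂ (λ u v → M * u - sq v) (Σsq-step per t) (Σ-step per t))
    (collect M (Σsq f) (shiftDistance f t) (Σ f))
    where
    collect : ∀ M S D X → M * (+ 4 * S - D) - (+ 2 * X) * (+ 2 * X) ≡ + 4 * (M * S - X * X) - M * D
    collect = solve-∀

  energy-step-decay : ∀ {f} → Periodic f → ∀ t → shiftDistance f t ≡ dirichlet f →
                      M * M * energy (step t f) + energy f ≤ + 4 * (M * M * energy f)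
  energy-step-decay {f} per t shift≡dirichlet =
    ≤-by-nonneg-difference _ difference (ℤP.i≤j⇒0≤j-i (energy-≤-dirichlet f))
    where
    collect : ∀ M E D → + 4 * (M * M * E) - (M * M * (+ 4 * E - M * D) + E) ≡ M * (M * (M * D)) - E
    collect = solve-∀
    difference : + 4 * (M * M * energy f) - (M * M * energy (step t f) + energy f) ≡ M * (M * (M * dirichlet f)) - energy f
    difference = trans (cong (λ z → + 4 * (M * M * energy f) - (M * M * z + energy f))
                             (trans (energy-step per t) (cong (λ d → + 4 * energy f - M * d) shift≡dirichlet)))
                       (collect M (energy f) (dirichlet f))

  shiftDistance-1 : ∀ f → shiftDistance f 1 ≡ dirichlet f
  shiftDistance-1 f = sumTo-ext m (λ b → trans (cong (λ z → sq (f b - f z)) (ℕP.+-comm b 1)) (sq-flip (f b) (f (suc b))))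
    where
    sq-flip : ∀ a c → (a - c) * (a - c) ≡ (c - a) * (c - a)
    sq-flip = solve-∀

  shiftDistance-m₁ : ∀ {f} → Periodic f → shiftDistance f m₁ ≡ dirichlet f
  shiftDistance-m₁ {f} per =
    trans (sym (Σ-rotate (Periodic-sq (λ i → cong₂ _-_ (per i) (Periodic-shift per m₁ i)))))
          (sumTo-ext m (λ b → cong (λ z → sq (f (suc b) - z)) (trans (cong f (sym (ℕP.+-suc b m₁))) (per b))))

  energy-shiftˡ : ∀ {f} → Periodic f → ∀ t → energy (λ b → f (t ℕ.+ b)) ≡ energy f
  energy-shiftˡ per t = cong₂ (λ u v → M * u - sq v) (Σ-shiftˡ (Periodic-sq per) t) (Σ-shiftˡ per t)

  covariance-≤ : ∀ (f g : ℕ → ℤ) → + 2 * (M * Σ (λ b → f b * g b) - Σ f * Σ g) ≤ energy f + energy g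
  covariance-≤ f g = M*-cancel-≤ (subst₂ _≤_ Σ2uv Σu²+v² (sumTo-mono-≤ m (λ b _ → 2*-≤-sq+sq (u b) (v b))))
    where
    u = λ b → M * f b - Σ f
    v = λ b → M * g b - Σ g
    collect : ∀ M X S T → + 2 * ((M * M) * X + (M * - T) * S + (- S * M) * T + M * (- S * - T))
                          ≡ M * (+ 2 * (M * X - S * T))
    collect = solve-∀
    Σ2uv : Σ (λ b → + 2 * (u b * v b)) ≡ M * (+ 2 * (M * Σ (λ b → f b * g b) - Σ f * Σ g))
    Σ2uv = trans (sumTo-* m (+ 2) (λ b → u b * v b))
      (trans (cong (+ 2 *_) (sumTo-bilinear m M (- Σ f) M (- Σ g) f g)) (collect M (Σ (λ b → f b * g b)) (Σ f) (Σ g)))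
    Σu²+v² : Σ (λ b → sq (u b) + sq (v b)) ≡ M * (energy f + energy g)
    Σu²+v² = trans (sumTo-+ m (λ b → sq (u b)) (λ b → sq (v b)))
      (trans (cong₂ _+_ (Σ-sq-deviation f) (Σ-sq-deviation g)) (sym (ℤP.*-distribˡ-+ M (energy f) (energy g))))

module Paths (m₁ : ℕ) where

  open import Data.Nat as ℕ using (ℕ; zero; suc; _%_)
  import Data.Nat.Properties as ℕP
  open import Data.Nat.DivMod using (m<n⇒m%n≡m; m%n<n; [m+n]%n≡m%n)
  open import Data.Integer using (ℤ; +_; _+_; _*_; _-_; _≤_; _^_; 0ℤ; 1ℤ)
  import Data.Integer.Properties as ℤP
  open import Data.Bool using (true; false; if_then_else_)
  open import Relation.Nullary using (does)
  open import Relation.Nullary.Decidable using (does-⇔)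
  open import Function using (_∘_; mk⇔)
  open import Relation.Binary.PropositionalEquality
  open IntegerFacts
  open Sums
  open PeriodicEnergy m₁

  kronecker : ℕ → ℕ → ℤ
  kronecker c a = if does (c ℕ.≟ a) then 1ℤ else 0ℤ

  sumTo-kronecker : ∀ n c (G : ℕ → ℤ) → c ℕ.< n → sumTo n (λ a → kronecker c a * G a) ≡ G c
  sumTo-kronecker (suc n) zero G _ = begin
      + 1 * G 0 + sumTo n (λ a → 0ℤ * G (suc a))   ≡⟨ cong (_+_ (+ 1 * G 0)) (sumTo-zero n) ⟩
      + 1 * G 0 + 0ℤ                               ≡⟨ ℤP.+-identityʳ _ ⟩
      + 1 * G 0                                    ≡⟨ ℤP.*-identityˡ (G 0) ⟩
      G 0                                          ∎
    where open ≡-Reasoning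
  sumTo-kronecker (suc n) (suc c) G (ℕ.s≤s c<n) = trans (ℤP.+-identityˡ _) (sumTo-kronecker n c (G ∘ suc) c<n)

  congruent : ℕ → ℕ → ℤ
  congruent s c = if does (s % m ℕ.≟ c % m) then 1ℤ else 0ℤ

  congruent-sym : ∀ s c → congruent s c ≡ congruent c s
  congruent-sym s c = cong (λ b → if b then 1ℤ else 0ℤ) (does-⇔ (mk⇔ sym sym) (s % m ℕ.≟ c % m) (c % m ℕ.≟ s % m))

  congruent-+ˡ : ∀ s c → congruent (s ℕ.+ m) c ≡ congruent s c
  congruent-+ˡ s c = cong (λ z → if does (z ℕ.≟ c % m) then 1ℤ else 0ℤ) ([m+n]%n≡m%n s m)

  congruent-+ʳ : ∀ s c → congruent s (c ℕ.+ m) ≡ congruent s c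
  congruent-+ʳ s c = cong (λ z → if does (s % m ℕ.≟ z) then 1ℤ else 0ℤ) ([m+n]%n≡m%n c m)

  congruent-idem : ∀ s c → sq (congruent s c) ≡ congruent s c
  congruent-idem s c with does (s % m ℕ.≟ c % m)
  ... | true = refl
  ... | false = refl

  Σ-congruent-* : ∀ x (G : ℕ → ℤ) → Σ (λ a → congruent x a * G a) ≡ G (x % m)
  Σ-congruent-* x G = trans (sumTo-cong m (λ a a<m → cong (λ z → (if does (x % m ℕ.≟ z) then 1ℤ else 0ℤ) * G a)
                                                         (m<n⇒m%n≡m a<m)))
                            (sumTo-kronecker m (x % m) G (m%n<n x m))

  Σ-congruentʳ : ∀ x → Σ (congruent x) ≡ 1ℤ
  Σ-congruentʳ x = trans (sumTo-ext m (λ a → sym (ℤP.*-identityʳ (congruent x a)))) (Σ-congruent-* x (λ _ → 1ℤ))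

  Σ-congruentˡ : ∀ c → Σ (λ s → congruent s c) ≡ 1ℤ
  Σ-congruentˡ c = trans (sumTo-ext m (λ s → congruent-sym s c)) (Σ-congruentʳ c)

  energy-congruentˡ : ∀ c → energy (λ s → congruent s c) ≡ M - 1ℤ
  energy-congruentˡ c = trans (cong₂ (λ u v → M * u - sq v)
      (trans (sumTo-ext m (λ s → congruent-idem s c)) (Σ-congruentˡ c)) (Σ-congruentˡ c))
    (cong (_- 1ℤ) (ℤP.*-identityʳ M))

  energy-congruentʳ : ∀ x → energy (congruent x) ≡ M - 1ℤ
  energy-congruentʳ x = trans (energy-cong (λ a → congruent-sym x a)) (energy-congruentˡ x)

  walk : ℕ → (ℕ → ℤ) → ℕ → ℕ → ℤ
  walk t f zero = f
  walk t f (suc k) = step t (walk t f k)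

  Periodic-walk : ∀ {f} t → Periodic f → ∀ k → Periodic (walk t f k)
  Periodic-walk t per zero = per
  Periodic-walk t per (suc k) = Periodic-step t (Periodic-walk t per k)

  Σ-walk : ∀ {f} t → Periodic f → ∀ k → Σ (walk t f k) ≡ (+ 2) ^ k * Σ f
  Σ-walk t per zero = sym (ℤP.*-identityˡ _)
  Σ-walk {f} t per (suc k) = trans (Σ-step (Periodic-walk t per k) t)
    (trans (cong (+ 2 *_) (Σ-walk t per k)) (sym (ℤP.*-assoc (+ 2) ((+ 2) ^ k) (Σ f))))

  -- paths c k s counts the bit strings of length k whose number of ones is ≡ c − s (mod m);
  -- binomialMod k b counts those whose number of ones is ≡ b, since step m₁ shifts by −1.
  paths : ℕ → ℕ → ℕ → ℤ
  paths c = walk 1 (λ s → congruent s c)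

  binomialMod : ℕ → ℕ → ℤ
  binomialMod = walk m₁ (congruent 0)

  Periodic-paths : ∀ c k → Periodic (paths c k)
  Periodic-paths c = Periodic-walk 1 (λ i → congruent-+ˡ i c)

  Periodic-binomialMod : ∀ k → Periodic (binomialMod k)
  Periodic-binomialMod = Periodic-walk m₁ (congruent-+ʳ 0)

  Σ-paths : ∀ c k → Σ (paths c k) ≡ (+ 2) ^ k
  Σ-paths c k = trans (Σ-walk 1 (λ i → congruent-+ˡ i c) k)
    (trans (cong ((+ 2) ^ k *_) (Σ-congruentˡ c)) (ℤP.*-identityʳ ((+ 2) ^ k)))

  Σ-binomialMod : ∀ k → Σ (binomialMod k) ≡ (+ 2) ^ k
  Σ-binomialMod k = trans (Σ-walk m₁ (congruent-+ʳ 0) k)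
    (trans (cong ((+ 2) ^ k *_) (Σ-congruentʳ 0)) (ℤP.*-identityʳ ((+ 2) ^ k)))

  paths-+ : ∀ c e d s → paths c (e ℕ.+ d) s ≡ Σ (λ b → binomialMod e b * paths c d (s ℕ.+ b))
  paths-+ c zero d s = sym (trans (Σ-congruent-* 0 (λ b → paths c d (s ℕ.+ b)))
    (cong (paths c d) (trans (cong (s ℕ.+_) (m<n⇒m%n≡m {n = m} (ℕ.s≤s ℕ.z≤n))) (ℕP.+-identityʳ s))))
  paths-+ c (suc e) d s = trans (cong₂ _+_ (paths-+ c e d s) (paths-+ c e d (s ℕ.+ 1)))
    (sym (trans (sumTo-ext m (λ b → ℤP.*-distribʳ-+ (G b) (binomialMod e b) (binomialMod e (b ℕ.+ m₁))))
         (trans (sumTo-+ m (λ b → binomialMod e b * G b) F) (cong (_+_ (Σ (λ b → binomialMod e b * G b))) Σ-rotated))))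
    where
    G = λ b → paths c d (s ℕ.+ b)
    F = λ b → binomialMod e (b ℕ.+ m₁) * G b
    Periodic-F : Periodic F
    Periodic-F i = cong₂ _*_ (Periodic-shift (Periodic-binomialMod e) m₁ i)
                             (trans (cong (paths c d) (sym (ℕP.+-assoc s i m))) (Periodic-paths c d (s ℕ.+ i)))
    Σ-rotated : Σ F ≡ Σ (λ b → binomialMod e b * paths c d ((s ℕ.+ 1) ℕ.+ b))
    Σ-rotated = trans (sym (Σ-rotate Periodic-F)) (sumTo-ext m (λ b → cong₂ _*_
      (trans (cong (binomialMod e) (sym (ℕP.+-suc b m₁))) (Periodic-binomialMod e b))
      (cong (paths c d) (sym (ℕP.+-assoc s 1 b)))))

  deviation : ℕ → ℕ → ℕ → ℤ
  deviation c k s = M * paths c k s - (+ 2) ^ k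

  deviation-double-≤ : ∀ c i s → + 2 * deviation c (i ℕ.+ i) s ≤ energy (binomialMod i) + energy (paths c i)
  deviation-double-≤ c i s = subst₂ _≤_ lhs rhs (covariance-≤ (binomialMod i) (λ b → paths c i (s ℕ.+ b)))
    where
    lhs : + 2 * (M * Σ (λ b → binomialMod i b * paths c i (s ℕ.+ b)) - Σ (binomialMod i) * Σ (λ b → paths c i (s ℕ.+ b)))
          ≡ + 2 * deviation c (i ℕ.+ i) s
    lhs = cong (+ 2 *_) (cong₂ _-_ (cong (M *_) (sym (paths-+ c i i s)))
      (trans (cong₂ _*_ (Σ-binomialMod i) (trans (Σ-shiftˡ (Periodic-paths c i) s) (Σ-paths c i)))
             (sym (ℤP.^-distribˡ-+-* (+ 2) i i))))
    rhs : energy (binomialMod i) + energy (λ b → paths c i (s ℕ.+ b)) ≡ energy (binomialMod i) + energy (paths c i)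
    rhs = cong (_+_ (energy (binomialMod i))) (energy-shiftˡ (Periodic-paths c i) s)

module HornerSums where

  open import Data.Nat as ℕ using (ℕ; zero; suc)
  import Data.Nat.Properties as ℕP
  open import Data.Integer as ℤ using (ℤ; +_; _+_; _*_; _-_; _≤_; _^_; 0ℤ; 1ℤ)
  import Data.Integer.Properties as ℤP
  open import Data.Integer.Tactic.RingSolver using (solve-∀)
  open import Relation.Binary.PropositionalEquality
  open IntegerFacts

  horner : ℤ → (ℕ → ℤ) → ℕ → ℤ
  horner r x zero = x 0
  horner r x (suc n) = r * horner r x n + x (suc n)

  horner-nonneg : ∀ {r x} → 0ℤ ≤ r → (∀ k → 0ℤ ≤ x k) → ∀ n → 0ℤ ≤ horner r x n
  horner-nonneg 0≤r 0≤x zero = 0≤x 0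
  horner-nonneg 0≤r 0≤x (suc n) = +-nonneg (*-nonneg 0≤r (horner-nonneg 0≤r 0≤x n)) (0≤x (suc n))

  horner-centred : ∀ (a : ℤ) (y : ℕ → ℤ) n →
    horner (+ 2) (λ k → a * y k - (+ 2) ^ k) n ≡ a * horner (+ 2) y n - + suc n * (+ 2) ^ n
  horner-centred a y zero = cong (a * y 0 -_) (sym (ℤP.*-identityˡ 1ℤ))
  horner-centred a y (suc n) = trans (cong (λ h → + 2 * h + (a * y (suc n) - + 2 * (+ 2) ^ n)) (horner-centred a y n))
    (collect a (horner (+ 2) y n) (y (suc n)) (+ suc n) ((+ 2) ^ n))
    where
    collect : ∀ a H y K P → + 2 * (a * H - K * P) + (a * y - + 2 * P) ≡ a * (+ 2 * H + y) - (+ 1 + K) * (+ 2 * P)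
    collect = solve-∀

  -- Telescoping the decay F (i + 1) ≤ (4 − 1/K) · F i against the weights 4^(i − j).
  module _ {K : ℤ} {F : ℕ → ℤ} (0≤K : 0ℤ ≤ K) (0≤F : ∀ i → 0ℤ ≤ F i)
           (decay : ∀ i → K * F (suc i) + F i ≤ + 4 * (K * F i)) where

    horner-decay : ∀ i → horner (+ 4) F i + K * F (suc i) ≤ K * ((+ 4) ^ suc i * F 0)
    horner-decay zero = subst₂ _≤_ (ℤP.+-comm (K * F 1) (F 0)) (collect K (F 0)) (decay 0)
      where
      collect : ∀ K x → + 4 * (K * x) ≡ K * ((+ 4 * 1ℤ) * x)
      collect = solve-∀
    horner-decay (suc i) = ℤP.≤-trans next
      (subst (+ 4 * (horner (+ 4) F i + K * F (suc i)) ≤_) (collect K ((+ 4) ^ suc i) (F 0))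
        (*-monoˡ-≤-nonneg (ℕ-nonneg 4) (horner-decay i)))
      where
      collect : ∀ K q x → + 4 * (K * (q * x)) ≡ K * ((+ 4 * q) * x)
      collect = solve-∀
      regroupˡ : ∀ v a b K → (+ 4 * v + a) + K * b ≡ + 4 * v + (K * b + a)
      regroupˡ = solve-∀
      regroupʳ : ∀ v K a → + 4 * v + + 4 * (K * a) ≡ + 4 * (v + K * a)
      regroupʳ = solve-∀
      next : horner (+ 4) F (suc i) + K * F (suc (suc i)) ≤ + 4 * (horner (+ 4) F i + K * F (suc i))
      next = subst₂ _≤_ (sym (regroupˡ (horner (+ 4) F i) (F (suc i)) (F (suc (suc i))) K))
                        (regroupʳ (horner (+ 4) F i) K (F (suc i)))
               (ℤP.+-monoʳ-≤ (+ 4 * horner (+ 4) F i) (decay (suc i)))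

    horner-decay-≤ : ∀ i → horner (+ 4) F i ≤ K * ((+ 4) ^ suc i * F 0)
    horner-decay-≤ i = ℤP.≤-trans (ℤP.i≤i+j (horner (+ 4) F i) (K * F (suc i)) {{ℤ.nonNegative (*-nonneg 0≤K (0≤F (suc i)))}})
      (horner-decay i)

  double : ℕ → ℕ
  double zero = zero
  double (suc i) = suc (suc (double i))

  double≡+ : ∀ i → double i ≡ i ℕ.+ i
  double≡+ zero = refl
  double≡+ (suc i) = cong suc (trans (cong suc (double≡+ i)) (sym (ℕP.+-suc i i)))

  data Parity : ℕ → Set where
    even : ∀ i → Parity (double i)
    odd : ∀ i → Parity (suc (double i))

  parity : ∀ n → Parity n
  parity zero = even 0
  parity (suc n) with parity n
  ... | even i = odd i
  ... | odd i = even (suc i)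

  pow4≡pow2-double : ∀ i → (+ 4) ^ i ≡ (+ 2) ^ double i
  pow4≡pow2-double zero = refl
  pow4≡pow2-double (suc i) = trans (cong (+ 4 *_) (pow4≡pow2-double i)) (ℤP.*-assoc (+ 2) (+ 2) _)

  module _ {F x : ℕ → ℤ} (0≤F : ∀ i → 0ℤ ≤ F i)
           (x-even : ∀ i → + 2 * x (double i) ≤ F i) (x-odd : ∀ i → + 2 * x (suc (double i)) ≤ F i + F i) where

    horner-odd-≤ : ∀ i → + 2 * horner (+ 2) x (suc (double i)) ≤ + 4 * horner (+ 4) F i
    horner-odd-≤ zero = subst₂ _≤_ (sym (expand (x 0) (x 1))) (collect (F 0))
      (ℤP.+-mono-≤ (*-monoˡ-≤-nonneg (ℕ-nonneg 2) (x-even 0)) (x-odd 0))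
      where
      expand : ∀ t y → + 2 * (+ 2 * t + y) ≡ + 2 * (+ 2 * t) + + 2 * y
      expand = solve-∀
      collect : ∀ f → + 2 * f + (f + f) ≡ + 4 * f
      collect = solve-∀
    horner-odd-≤ (suc i) = subst₂ _≤_ (sym (expand T xₑ xₒ)) (collect (horner (+ 4) F i) (F (suc i)))
      (ℤP.+-mono-≤ (ℤP.+-mono-≤ (*-monoˡ-≤-nonneg (ℕ-nonneg 2) (*-monoˡ-≤-nonneg (ℕ-nonneg 2) (horner-odd-≤ i)))
                                (*-monoˡ-≤-nonneg (ℕ-nonneg 2) (x-even (suc i))))
                   (x-odd (suc i)))
      where
      T = horner (+ 2) x (suc (double i))
      xₑ = x (double (suc i))
      xₒ = x (suc (double (suc i)))
      expand : ∀ t a b → + 2 * (+ 2 * (+ 2 * t + a) + b) ≡ + 2 * (+ 2 * (+ 2 * t)) + + 2 * (+ 2 * a) + + 2 * b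
      expand = solve-∀
      collect : ∀ v f → + 2 * (+ 2 * (+ 4 * v)) + + 2 * f + (f + f) ≡ + 4 * (+ 4 * v + f)
      collect = solve-∀

    horner-even-≤ : ∀ i → + 2 * horner (+ 2) x (double i) ≤ + 4 * horner (+ 4) F i
    horner-even-≤ zero = ℤP.≤-trans (x-even 0)
      (≤-by-nonneg-difference (+ 3 * F 0) (collect (F 0)) (*-nonneg (ℕ-nonneg 3) (0≤F 0)))
      where
      collect : ∀ f → + 4 * f - f ≡ + 3 * f
      collect = solve-∀
    horner-even-≤ (suc i) = ℤP.≤-trans
      (subst (_≤ + 2 * (+ 4 * V) + F (suc i)) (sym (ℤP.*-distribˡ-+ (+ 2) (+ 2 * horner (+ 2) x (suc (double i))) (x (double (suc i)))))
        (ℤP.+-mono-≤ (*-monoˡ-≤-nonneg (ℕ-nonneg 2) (horner-odd-≤ i)) (x-even (suc i))))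
      (≤-by-nonneg-difference _ (collect V (F (suc i)))
        (+-nonneg (*-nonneg (ℕ-nonneg 8) (horner-nonneg (ℕ-nonneg 4) 0≤F i)) (*-nonneg (ℕ-nonneg 3) (0≤F (suc i)))))
      where
      V = horner (+ 4) F i
      collect : ∀ v f → + 4 * (+ 4 * v + f) - (+ 2 * (+ 4 * v) + f) ≡ + 8 * v + + 3 * f
      collect = solve-∀

    horner-by-pairs-≤ : ∀ {C} → 0ℤ ≤ C → (∀ i → + 4 * horner (+ 4) F i ≤ C * (+ 4) ^ i) →
                        ∀ n → + 2 * horner (+ 2) x n ≤ C * (+ 2) ^ n
    horner-by-pairs-≤ {C} 0≤C bound n with parity n
    ... | even i = ℤP.≤-trans (horner-even-≤ i) (subst (λ p → + 4 * horner (+ 4) F i ≤ C * p) (pow4≡pow2-double i) (bound i))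
    ... | odd i = ℤP.≤-trans (horner-odd-≤ i) (ℤP.≤-trans (bound i) (*-monoˡ-≤-nonneg 0≤C
      (subst (λ p → (+ 4) ^ i ≤ + 2 * p) (pow4≡pow2-double i) (≤-2* (subst (0ℤ ≤_) (pos-^ 4 i) (ℕ-nonneg _))))))

module PathBounds (m₁ : ℕ) where

  open import Data.Nat as ℕ using (ℕ; suc)
  open import Data.Integer using (ℤ; +_; _+_; _*_; _-_; _≤_; _^_; 0ℤ; 1ℤ)
  import Data.Integer.Properties as ℤP
  open import Data.Integer.Tactic.RingSolver using (solve-∀)
  open import Relation.Binary.PropositionalEquality
  open IntegerFacts
  open PeriodicEnergy m₁
  open Paths m₁
  open HornerSums

  M³ : ℤ
  M³ = M * (M * M)

  module _ (c : ℕ) where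

    pairEnergy : ℕ → ℤ
    pairEnergy i = energy (binomialMod i) + energy (paths c i)

    pairEnergy-nonneg : ∀ i → 0ℤ ≤ pairEnergy i
    pairEnergy-nonneg i = +-nonneg (energy-nonneg (binomialMod i)) (energy-nonneg (paths c i))

    pairEnergy-decay : ∀ i → M * M * pairEnergy (suc i) + pairEnergy i ≤ + 4 * (M * M * pairEnergy i)
    pairEnergy-decay i = subst₂ _≤_ (regroup (M * M) (energy (binomialMod (suc i))) (energy (paths c (suc i)))
                                             (energy (binomialMod i)) (energy (paths c i)))
                                    (distrib (M * M) (energy (binomialMod i)) (energy (paths c i)))
      (ℤP.+-mono-≤ (energy-step-decay (Periodic-binomialMod i) m₁ (shiftDistance-m₁ (Periodic-binomialMod i)))
                   (energy-step-decay (Periodic-paths c i) 1 (shiftDistance-1 (paths c i))))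
      where
      regroup : ∀ K a b x y → (K * a + x) + (K * b + y) ≡ K * (a + b) + (x + y)
      regroup = solve-∀
      distrib : ∀ K x y → + 4 * (K * x) + + 4 * (K * y) ≡ + 4 * (K * (x + y))
      distrib = solve-∀

    pairEnergy-zero-≤ : pairEnergy 0 ≤ + 2 * M
    pairEnergy-zero-≤ = ≤-by-nonneg-difference (+ 2)
      (trans (cong (λ e → + 2 * M - e) (cong₂ _+_ (energy-congruentʳ 0) (energy-congruentˡ c))) (difference M))
      (ℕ-nonneg 2)
      where
      difference : ∀ M → + 2 * M - ((M - 1ℤ) + (M - 1ℤ)) ≡ + 2
      difference = solve-∀

    horner-pairEnergy-≤ : ∀ i → + 4 * horner (+ 4) pairEnergy i ≤ + 32 * M³ * (+ 4) ^ i
    horner-pairEnergy-≤ i = ℤP.≤-trans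
      (*-monoˡ-≤-nonneg (ℕ-nonneg 4) (ℤP.≤-trans (horner-decay-≤ (sq-nonneg M) pairEnergy-nonneg pairEnergy-decay i)
        (*-monoˡ-≤-nonneg (sq-nonneg M) (*-monoˡ-≤-nonneg pow-nonneg pairEnergy-zero-≤))))
      (ℤP.≤-reflexive (collect M ((+ 4) ^ i)))
      where
      pow-nonneg : 0ℤ ≤ (+ 4) ^ suc i
      pow-nonneg = subst (0ℤ ≤_) (pos-^ 4 (suc i)) (ℕ-nonneg _)
      collect : ∀ M q → + 4 * (M * M * ((+ 4 * q) * (+ 2 * M))) ≡ + 32 * (M * (M * M)) * q
      collect = solve-∀

    deviation-even-≤ : ∀ s i → + 2 * deviation c (double i) s ≤ pairEnergy i
    deviation-even-≤ s i = subst (λ k → + 2 * deviation c k s ≤ pairEnergy i) (sym (double≡+ i)) (deviation-double-≤ c i s)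

    deviation-odd-≤ : ∀ s i → + 2 * deviation c (suc (double i)) s ≤ pairEnergy i + pairEnergy i
    deviation-odd-≤ s i = subst (_≤ pairEnergy i + pairEnergy i) (sym (split M (paths c k s) (paths c k (s ℕ.+ 1)) ((+ 2) ^ k)))
      (ℤP.+-mono-≤ (deviation-even-≤ s i) (deviation-even-≤ (s ℕ.+ 1) i))
      where
      k = double i
      split : ∀ M a b P → + 2 * (M * (a + b) - + 2 * P) ≡ + 2 * (M * a - P) + + 2 * (M * b - P)
      split = solve-∀

    horner-paths-≤ : ∀ s n → M * horner (+ 2) (λ k → paths c k s) n ≤ + suc n * (+ 2) ^ n + + 16 * M³ * (+ 2) ^ n
    horner-paths-≤ s n = ≤-by-nonneg-difference _ (rearrange MY K M³ P)
      (ℤP.*-cancelˡ-≤-pos 0ℤ _ (+ 2) (subst₂ _≤_ (sym (ℤP.*-zeroʳ (+ 2))) (sym (halve MY K M³ P)) (ℤP.i≤j⇒0≤j-i twice-bound)))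
      where
      MY = M * horner (+ 2) (λ k → paths c k s) n
      K = + suc n * (+ 2) ^ n
      P = (+ 2) ^ n
      twice-bound : + 2 * (MY - K) ≤ + 32 * M³ * P
      twice-bound = subst (λ h → + 2 * h ≤ + 32 * M³ * P) (horner-centred M (λ k → paths c k s) n)
        (horner-by-pairs-≤ pairEnergy-nonneg (deviation-even-≤ s) (deviation-odd-≤ s)
          (*-nonneg (ℕ-nonneg 32) (*-nonneg (ℕ-nonneg m) (sq-nonneg M))) horner-pairEnergy-≤ n)
      rearrange : ∀ y k c p → k + + 16 * c * p - y ≡ + 16 * c * p - (y - k)
      rearrange = solve-∀
      halve : ∀ y k c p → + 2 * (+ 16 * c * p - (y - k)) ≡ + 32 * c * p - + 2 * (y - k)
      halve = solve-∀

module BitStrings (m₁ : ℕ) where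

  open import Data.Nat as ℕ using (ℕ; zero; suc; _%_)
  import Data.Nat.Properties as ℕP
  open import Data.Integer as ℤ using (ℤ; +_; _+_; _*_; _-_; _≤_; _^_; 0ℤ; 1ℤ)
  import Data.Integer.Properties as ℤP
  open import Data.Integer.Tactic.RingSolver using (solve-∀)
  open import Data.Bool using (Bool; true; false)
  open import Data.List using (List; []; _∷_)
  open import Relation.Binary.PropositionalEquality
  open IntegerFacts
  open Sums
  open PeriodicEnergy m₁
  open Paths m₁
  open HornerSums
  open PathBounds m₁

  sumBits : ℕ → (List Bool → ℤ) → ℤ
  sumBits zero f = f []
  sumBits (suc n) f = sumBits n (λ xs → f (true ∷ xs)) + sumBits n (λ xs → f (false ∷ xs))

  sumBits-ext : ∀ n {f g : List Bool → ℤ} → (∀ xs → f xs ≡ g xs) → sumBits n f ≡ sumBits n g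
  sumBits-ext zero eq = eq []
  sumBits-ext (suc n) eq = cong₂ _+_ (sumBits-ext n (λ xs → eq (true ∷ xs))) (sumBits-ext n (λ xs → eq (false ∷ xs)))

  sumBits-+ : ∀ n (f g : List Bool → ℤ) → sumBits n (λ xs → f xs + g xs) ≡ sumBits n f + sumBits n g
  sumBits-+ zero f g = refl
  sumBits-+ (suc n) f g = trans
    (cong₂ _+_ (sumBits-+ n (λ xs → f (true ∷ xs)) (λ xs → g (true ∷ xs))) (sumBits-+ n (λ xs → f (false ∷ xs)) (λ xs → g (false ∷ xs))))
    (interchange (sumBits n (λ xs → f (true ∷ xs))) (sumBits n (λ xs → g (true ∷ xs)))
                 (sumBits n (λ xs → f (false ∷ xs))) (sumBits n (λ xs → g (false ∷ xs))))
    where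
    interchange : ∀ a b c d → (a + b) + (c + d) ≡ (a + c) + (b + d)
    interchange = solve-∀

  sumBits-* : ∀ n c (f : List Bool → ℤ) → sumBits n (λ xs → c * f xs) ≡ c * sumBits n f
  sumBits-* zero c f = refl
  sumBits-* (suc n) c f = trans (cong₂ _+_ (sumBits-* n c (λ xs → f (true ∷ xs))) (sumBits-* n c (λ xs → f (false ∷ xs))))
    (sym (ℤP.*-distribˡ-+ c _ _))

  sumBits-const : ∀ n c → sumBits n (λ _ → c) ≡ (+ 2) ^ n * c
  sumBits-const zero c = sym (ℤP.*-identityˡ c)
  sumBits-const (suc n) c = trans (cong₂ _+_ (sumBits-const n c) (sumBits-const n c)) (twice ((+ 2) ^ n) c)
    where
    twice : ∀ p c → p * c + p * c ≡ (+ 2 * p) * c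
    twice = solve-∀

  bit : Bool → ℕ
  bit true = 1
  bit false = 0

  hits : ℕ → ℕ → List Bool → ℤ
  hits a s [] = congruent s a
  hits a s (x ∷ xs) = congruent s a + hits a (s ℕ.+ bit x) xs

  horner-paths-suc : ∀ c n u → horner (+ 2) (λ k → paths c k u) n + horner (+ 2) (λ k → paths c k (u ℕ.+ 1)) n
                               + (+ 2) ^ suc n * congruent u c ≡ horner (+ 2) (λ k → paths c k u) (suc n)
  horner-paths-suc c zero u = collect (congruent u c) (congruent (u ℕ.+ 1) c)
    where
    collect : ∀ a b → a + b + (+ 2 * 1ℤ) * a ≡ + 2 * a + (a + b)
    collect = solve-∀
  horner-paths-suc c (suc n) u = trans
    (collect (horner (+ 2) (λ k → paths c k u) n) (horner (+ 2) (λ k → paths c k (u ℕ.+ 1)) n)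
             (paths c (suc n) u) (paths c (suc n) (u ℕ.+ 1)) ((+ 2) ^ suc n) (congruent u c))
    (cong (λ z → + 2 * z + (paths c (suc n) u + paths c (suc n) (u ℕ.+ 1))) (horner-paths-suc c n u))
    where
    collect : ∀ y₁ y₂ a b p i → (+ 2 * y₁ + a) + (+ 2 * y₂ + b) + (+ 2 * p) * i ≡ + 2 * (y₁ + y₂ + p * i) + (a + b)
    collect = solve-∀

  sumBits-hits : ∀ c n u → sumBits n (hits c u) ≡ horner (+ 2) (λ k → paths c k u) n
  sumBits-hits c zero u = refl
  sumBits-hits c (suc n) u = begin
      sumBits n (λ xs → ι + hits c (u ℕ.+ 1) xs) + sumBits n (λ xs → ι + hits c (u ℕ.+ 0) xs)
    ≡⟨ cong₂ _+_ (sumBits-+ n (λ _ → ι) (hits c (u ℕ.+ 1)))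
                 (trans (sumBits-ext n (λ xs → cong (λ v → ι + hits c v xs) (ℕP.+-identityʳ u))) (sumBits-+ n (λ _ → ι) (hits c u))) ⟩
      (sumBits n (λ _ → ι) + sumBits n (hits c (u ℕ.+ 1))) + (sumBits n (λ _ → ι) + sumBits n (hits c u))
    ≡⟨ cong₂ (λ p q → (p + sumBits n (hits c (u ℕ.+ 1))) + (p + q)) (sumBits-const n ι) (sumBits-hits c n u) ⟩
      ((+ 2) ^ n * ι + sumBits n (hits c (u ℕ.+ 1))) + ((+ 2) ^ n * ι + horner (+ 2) (λ k → paths c k u) n)
    ≡⟨ cong (λ q → ((+ 2) ^ n * ι + q) + ((+ 2) ^ n * ι + horner (+ 2) (λ k → paths c k u) n)) (sumBits-hits c n (u ℕ.+ 1)) ⟩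
      ((+ 2) ^ n * ι + horner (+ 2) (λ k → paths c k (u ℕ.+ 1)) n) + ((+ 2) ^ n * ι + horner (+ 2) (λ k → paths c k u) n)
    ≡⟨ collect ((+ 2) ^ n) ι _ _ ⟩
      horner (+ 2) (λ k → paths c k u) n + horner (+ 2) (λ k → paths c k (u ℕ.+ 1)) n + (+ 2) ^ suc n * ι
    ≡⟨ horner-paths-suc c n u ⟩
      horner (+ 2) (λ k → paths c k u) (suc n)
    ∎
    where
    open ≡-Reasoning
    ι = congruent u c
    collect : ∀ p i a b → (p * i + a) + (p * i + b) ≡ b + a + (+ 2 * p) * i
    collect = solve-∀

  hitEnergy : ℕ → List Bool → ℤ
  hitEnergy s xs = Σ (λ a → sq (hits a s xs))

  hitEnergy-[] : ∀ s → hitEnergy s [] ≡ 1ℤ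
  hitEnergy-[] s = trans (sumTo-ext m (congruent-idem s)) (Σ-congruentʳ s)

  hitEnergy-∷ : ∀ s x xs → hitEnergy s (x ∷ xs) ≡ 1ℤ + + 2 * hits (s % m) (s ℕ.+ bit x) xs + hitEnergy (s ℕ.+ bit x) xs
  hitEnergy-∷ s x xs = begin
      Σ (λ a → sq (congruent s a + hits a s′ xs))
    ≡⟨ sumTo-ext m (λ a → expand (congruent s a) (hits a s′ xs)) ⟩
      Σ (λ a → sq (congruent s a) + + 2 * (congruent s a * hits a s′ xs) + sq (hits a s′ xs))
    ≡⟨ sumTo-+ m (λ a → sq (congruent s a) + + 2 * (congruent s a * hits a s′ xs)) (λ a → sq (hits a s′ xs)) ⟩
      Σ (λ a → sq (congruent s a) + + 2 * (congruent s a * hits a s′ xs)) + hitEnergy s′ xs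
    ≡⟨ cong (_+ hitEnergy s′ xs) (sumTo-+ m (λ a → sq (congruent s a)) (λ a → + 2 * (congruent s a * hits a s′ xs))) ⟩
      Σ (λ a → sq (congruent s a)) + Σ (λ a → + 2 * (congruent s a * hits a s′ xs)) + hitEnergy s′ xs
    ≡⟨ cong (λ z → z + Σ (λ a → + 2 * (congruent s a * hits a s′ xs)) + hitEnergy s′ xs) (hitEnergy-[] s) ⟩
      1ℤ + Σ (λ a → + 2 * (congruent s a * hits a s′ xs)) + hitEnergy s′ xs
    ≡⟨ cong (λ z → 1ℤ + z + hitEnergy s′ xs)
            (trans (sumTo-* m (+ 2) (λ a → congruent s a * hits a s′ xs)) (cong (+ 2 *_) (Σ-congruent-* s (λ a → hits a s′ xs)))) ⟩
      1ℤ + + 2 * hits (s % m) s′ xs + hitEnergy s′ xs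
    ∎
    where
    open ≡-Reasoning
    s′ = s ℕ.+ bit x
    expand : ∀ i k → (i + k) * (i + k) ≡ i * i + + 2 * (i * k) + k * k
    expand = solve-∀

  sumBits-hitEnergy-∷ : ∀ n s b → sumBits n (λ xs → hitEnergy s (b ∷ xs))
    ≡ (+ 2) ^ n * 1ℤ + + 2 * sumBits n (hits (s % m) (s ℕ.+ bit b)) + sumBits n (hitEnergy (s ℕ.+ bit b))
  sumBits-hitEnergy-∷ n s b = trans (sumBits-ext n (hitEnergy-∷ s b))
    (trans (sumBits-+ n (λ xs → 1ℤ + + 2 * hits (s % m) s′ xs) (hitEnergy s′))
      (cong (_+ sumBits n (hitEnergy s′)) (trans (sumBits-+ n (λ _ → 1ℤ) (λ xs → + 2 * hits (s % m) s′ xs))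
        (cong₂ _+_ (sumBits-const n 1ℤ) (sumBits-* n (+ 2) (hits (s % m) s′))))))
    where
    s′ = s ℕ.+ bit b

  M≤M³ : M ≤ M³
  M≤M³ = subst (M ≤_) (trans (ℤP.pos-* m (m ℕ.* m)) (cong (M *_) (ℤP.pos-* m m))) (ℤ.+≤+ (ℕP.m≤m*n m (m ℕ.* m)))

  M³-nonneg : 0ℤ ≤ M³
  M³-nonneg = *-nonneg (ℕ-nonneg m) (sq-nonneg M)

  hitEnergyBound : ℕ → ℤ
  hitEnergyBound n = + suc n * + suc n + + 33 * M³ * + suc n

  sumBits-hitEnergy-≤ : ∀ n s → M * sumBits n (hitEnergy s) ≤ (+ 2) ^ n * hitEnergyBound n
  sumBits-hitEnergy-≤ zero s = subst₂ _≤_ (sym (cong (M *_) (hitEnergy-[] s))) (sym (ℤP.*-identityˡ (hitEnergyBound 0)))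
    (≤-by-nonneg-difference _ (difference M M³)
      (+-nonneg (+-nonneg (ℕ-nonneg 1) (*-nonneg (ℕ-nonneg 32) M³-nonneg)) (ℤP.i≤j⇒0≤j-i M≤M³)))
    where
    difference : ∀ M C → (+ 1 * + 1 + + 33 * C * + 1) - M * 1ℤ ≡ 1ℤ + + 32 * C + (C - M)
    difference = solve-∀
  sumBits-hitEnergy-≤ (suc n) s = ℤP.≤-trans
    (subst (_≤ P * S + P * S) (sym (ℤP.*-distribˡ-+ M (sumBits n (λ xs → hitEnergy s (true ∷ xs))) (sumBits n (λ xs → hitEnergy s (false ∷ xs))))) (ℤP.+-mono-≤ (first-bit true) (first-bit false)))
    (≤-by-nonneg-difference _ (difference P M M³ (+ suc n))
      (*-nonneg (*-nonneg (ℕ-nonneg 2) (subst (0ℤ ≤_) (pos-^ 2 n) (ℕ-nonneg _)))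
                (subst (0ℤ ≤_) (regroup M³ M) (+-nonneg (ℕ-nonneg 1) (ℤP.i≤j⇒0≤j-i M≤M³)))))
    where
    P = (+ 2) ^ n
    S = M + + 2 * + suc n + + 32 * M³ + hitEnergyBound n
    regroup : ∀ C M → 1ℤ + (C - M) ≡ 1ℤ + C - M
    regroup = solve-∀
    difference : ∀ p M C K →
      (+ 2 * p) * ((+ 1 + K) * (+ 1 + K) + + 33 * C * (+ 1 + K))
        - (p * (M + + 2 * K + + 32 * C + (K * K + + 33 * C * K)) + p * (M + + 2 * K + + 32 * C + (K * K + + 33 * C * K)))
      ≡ (+ 2 * p) * (1ℤ + C - M)
    difference = solve-∀
    expand : ∀ M p W B → M * (p * 1ℤ + + 2 * W + B) ≡ M * p + + 2 * (M * W) + M * B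
    expand = solve-∀
    collect : ∀ M p K C R → M * p + + 2 * (K * p + + 16 * C * p) + p * R ≡ p * (M + + 2 * K + + 32 * C + R)
    collect = solve-∀
    first-bit : ∀ b → M * sumBits n (λ xs → hitEnergy s (b ∷ xs)) ≤ P * S
    first-bit b = subst₂ _≤_
      (sym (trans (cong (M *_) (sumBits-hitEnergy-∷ n s b)) (expand M P (sumBits n (hits (s % m) s′)) (sumBits n (hitEnergy s′)))))
      (collect M P (+ suc n) M³ (hitEnergyBound n))
      (ℤP.+-mono-≤ (ℤP.+-monoʳ-≤ (M * P) (*-monoˡ-≤-nonneg (ℕ-nonneg 2)
          (subst (λ z → M * z ≤ + suc n * P + + 16 * M³ * P) (sym (sumBits-hits (s % m) n s′)) (horner-paths-≤ (s % m) s′ n))))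
        (sumBits-hitEnergy-≤ n s′))
      where
      s′ = s ℕ.+ bit b

module HitCounts (m₁ : ℕ) where

  open import Data.Nat as ℕ using (ℕ; zero; suc; _%_)
  import Data.Nat.Properties as ℕP
  open import Data.Integer using (ℤ; +_; _+_; _*_; _-_; -_; _≤_; _^_; 0ℤ; 1ℤ)
  import Data.Integer.Properties as ℤP
  open import Data.Integer.Tactic.RingSolver using (solve-∀)
  open import Data.Bool using (Bool; true; false; if_then_else_)
  open import Data.List using (List; []; _∷_; map; _++_; upTo; applyUpTo; filter; length; take; foldr)
  open import Relation.Nullary using (does)
  open import Relation.Unary using (Pred; Decidable)
  open import Level using (0ℓ)
  open import Relation.Binary.PropositionalEquality
  open import Function using (_∘_; id)
  open import Defs using (allBits; ones; partialSum; hitCount)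
  open IntegerFacts
  open Sums
  open PeriodicEnergy m₁
  open Paths m₁
  open PathBounds m₁ using (M³)
  open BitStrings m₁

  sumList : ∀ {A : Set} → List A → (A → ℤ) → ℤ
  sumList l f = foldr (λ x acc → f x + acc) 0ℤ l

  sumList-++ : ∀ {A : Set} (l₁ l₂ : List A) f → sumList (l₁ ++ l₂) f ≡ sumList l₁ f + sumList l₂ f
  sumList-++ [] l₂ f = sym (ℤP.+-identityˡ _)
  sumList-++ (x ∷ l₁) l₂ f = trans (cong (_+_ (f x)) (sumList-++ l₁ l₂ f)) (sym (ℤP.+-assoc (f x) (sumList l₁ f) (sumList l₂ f)))

  sumList-map : ∀ {A B : Set} (h : A → B) (l : List A) f → sumList (map h l) f ≡ sumList l (f ∘ h)
  sumList-map h [] f = refl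
  sumList-map h (x ∷ l) f = cong (_+_ (f (h x))) (sumList-map h l f)

  sumList-applyUpTo : ∀ (h : ℕ → ℕ) k f → sumList (applyUpTo h k) f ≡ sumTo k (f ∘ h)
  sumList-applyUpTo h zero f = refl
  sumList-applyUpTo h (suc k) f = cong (_+_ (f (h 0))) (sumList-applyUpTo (h ∘ suc) k f)

  sumList-allBits : ∀ n f → sumList (allBits n) f ≡ sumBits n f
  sumList-allBits zero f = ℤP.+-identityʳ (f [])
  sumList-allBits (suc n) f = trans (sumList-++ (map (true ∷_) (allBits n)) (map (false ∷_) (allBits n)) f)
    (cong₂ _+_ (trans (sumList-map (true ∷_) (allBits n) f) (sumList-allBits n (λ xs → f (true ∷ xs))))
               (trans (sumList-map (false ∷_) (allBits n) f) (sumList-allBits n (λ xs → f (false ∷ xs)))))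

  length-filter : ∀ {A : Set} {P : Pred A 0ℓ} (P? : Decidable P) l →
                  + length (filter P? l) ≡ sumList l (λ x → if does (P? x) then 1ℤ else 0ℤ)
  length-filter P? [] = refl
  length-filter P? (x ∷ l) with does (P? x)
  ... | false = trans (length-filter P? l) (sym (ℤP.+-identityˡ _))
  ... | true = trans (ℤP.pos-+ 1 (length (filter P? l))) (cong (_+_ 1ℤ) (length-filter P? l))

  hitCount≡sumTo : ∀ a N bs → + hitCount m a N bs ≡ sumTo N (λ j → congruent (partialSum bs (suc j)) a)
  hitCount≡sumTo a N bs = trans (length-filter (λ j → (partialSum bs j % m) ℕ.≟ (a % m)) (map suc (upTo N)))
    (trans (sumList-map suc (upTo N) (λ j → congruent (partialSum bs j) a)) (sumList-applyUpTo id N _))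

  ones-∷ : ∀ b l → ones (b ∷ l) ≡ bit b ℕ.+ ones l
  ones-∷ true l = refl
  ones-∷ false l = refl

  sumTo-congruent-partialSums : ∀ a xs s →
    sumTo (suc (length xs)) (λ j → congruent (s ℕ.+ ones (take j xs)) a) ≡ hits a s xs
  sumTo-congruent-partialSums a [] s = trans (ℤP.+-identityʳ _) (cong (λ z → congruent z a) (ℕP.+-identityʳ s))
  sumTo-congruent-partialSums a (x ∷ xs) s = cong₂ _+_ (cong (λ z → congruent z a) (ℕP.+-identityʳ s))
    (trans (sumTo-ext (suc (length xs)) (λ j → cong (λ z → congruent z a)
             (trans (cong (s ℕ.+_) (ones-∷ x (take j xs))) (sym (ℕP.+-assoc s (bit x) _)))))
           (sumTo-congruent-partialSums a xs (s ℕ.+ bit x)))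

  hitCount≡hits : ∀ a b bs → + hitCount m a (suc (length bs)) (b ∷ bs) ≡ hits a (bit b) bs
  hitCount≡hits a b bs = trans (hitCount≡sumTo a (suc (length bs)) (b ∷ bs))
    (trans (sumTo-ext (suc (length bs)) (λ j → cong (λ z → congruent z a) (ones-∷ b (take j bs))))
           (sumTo-congruent-partialSums a bs (bit b)))

  Σ-sumBits-swap : ∀ n (F : ℕ → List Bool → ℤ) → Σ (λ a → sumBits n (F a)) ≡ sumBits n (λ bs → Σ (λ a → F a bs))
  Σ-sumBits-swap zero F = refl
  Σ-sumBits-swap (suc n) F = trans (sumTo-+ m (λ a → sumBits n (λ xs → F a (true ∷ xs))) (λ a → sumBits n (λ xs → F a (false ∷ xs))))
    (cong₂ _+_ (Σ-sumBits-swap n (λ a xs → F a (true ∷ xs))) (Σ-sumBits-swap n (λ a xs → F a (false ∷ xs))))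

  sumBits-cong : ∀ n {f g : List Bool → ℤ} → (∀ xs → length xs ≡ n → f xs ≡ g xs) → sumBits n f ≡ sumBits n g
  sumBits-cong zero eq = eq [] refl
  sumBits-cong (suc n) eq = cong₂ _+_ (sumBits-cong n (λ xs e → eq (true ∷ xs) (cong suc e)))
                                     (sumBits-cong n (λ xs e → eq (false ∷ xs) (cong suc e)))

  module _ (n : ℕ) where

    N : ℕ
    N = suc n

    hitCountℤ : ℕ → List Bool → ℤ
    hitCountℤ a bs = + hitCount m a N bs

    Σ-hitCount : ∀ bs → Σ (λ a → hitCountℤ a bs) ≡ + N
    Σ-hitCount bs = trans (sumTo-ext m (λ a → hitCount≡sumTo a N bs))
      (trans (sumTo-swap m N (λ a j → congruent (partialSum bs (suc j)) a))
      (trans (sumTo-ext N (λ j → Σ-congruentʳ (partialSum bs (suc j))))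
      (trans (sumTo-const N 1ℤ) (ℤP.*-identityʳ (+ N)))))

    hitSquares : List Bool → ℤ
    hitSquares bs = Σ (λ a → sq (hitCountℤ a bs))

    Σ-centred-hitCount² : ∀ bs → Σ (λ a → sq (M * hitCountℤ a bs - + N)) ≡ (M * M) * hitSquares bs + - (M * (+ N * + N))
    Σ-centred-hitCount² bs = trans (sumTo-ext m (λ a → expand M (+ N) (hitCountℤ a bs)))
      (trans (sumTo-quadratic m (M * M) (- (+ 2 * M * + N)) (+ N * + N) (λ a → hitCountℤ a bs))
      (trans (cong (λ z → (M * M) * hitSquares bs + - (+ 2 * M * + N) * z + M * (+ N * + N)) (Σ-hitCount bs))
             (collect M (+ N) (hitSquares bs))))
      where
      expand : ∀ M K x → (M * x - K) * (M * x - K) ≡ (M * M) * (x * x) + - (+ 2 * M * K) * x + K * K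
      expand = solve-∀
      collect : ∀ M K H → (M * M) * H + - (+ 2 * M * K) * K + M * (K * K) ≡ (M * M) * H + - (M * (K * K))
      collect = solve-∀

    -- The first bit is X̃₁, so the walk starts at S̃₁ = bit b.
    sumBits-hitSquares : sumBits N hitSquares ≡ sumBits n (hitEnergy 1) + sumBits n (hitEnergy 0)
    sumBits-hitSquares = cong₂ _+_ (first-bit true) (first-bit false)
      where
      first-bit : ∀ b → sumBits n (λ xs → hitSquares (b ∷ xs)) ≡ sumBits n (hitEnergy (bit b))
      first-bit b = sumBits-cong n (λ xs len → sumTo-ext m (λ a → cong sq
        (trans (cong (λ z → + hitCount m a (suc z) (b ∷ xs)) (sym len)) (hitCount≡hits a b xs))))

    M*sumBits-hitSquares-≤ : M * sumBits N hitSquares ≤ (+ 2) ^ N * hitEnergyBound n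
    M*sumBits-hitSquares-≤ = subst₂ _≤_
      (sym (trans (cong (M *_) sumBits-hitSquares) (ℤP.*-distribˡ-+ M (sumBits n (hitEnergy 1)) (sumBits n (hitEnergy 0)))))
      (twice ((+ 2) ^ n) (hitEnergyBound n))
      (ℤP.+-mono-≤ (sumBits-hitEnergy-≤ n 1) (sumBits-hitEnergy-≤ n 0))
      where
      twice : ∀ p r → p * r + p * r ≡ (+ 2 * p) * r
      twice = solve-∀

    centredHitEnergy : ℤ
    centredHitEnergy = Σ (λ a → sumBits N (λ bs → sq (M * hitCountℤ a bs - + N)))

    centredHitEnergy-≤ : centredHitEnergy ≤ M * (+ 33 * M³ * + N * (+ 2) ^ N)
    centredHitEnergy-≤ = subst (_≤ M * (+ 33 * M³ * + N * (+ 2) ^ N)) (sym centredHitEnergy≡)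
      (ℤP.≤-trans (ℤP.≤-reflexive (regroup M (sumBits N hitSquares) ((+ 2) ^ N) (+ N)))
        (ℤP.≤-trans (ℤP.+-monoˡ-≤ (- (M * ((+ 2) ^ N * (+ N * + N)))) (*-monoˡ-≤-nonneg (ℕ-nonneg m) M*sumBits-hitSquares-≤))
          (ℤP.≤-reflexive (collect M ((+ 2) ^ N) (+ N) M³))))
      where
      centredHitEnergy≡ : centredHitEnergy ≡ (M * M) * sumBits N hitSquares + (+ 2) ^ N * - (M * (+ N * + N))
      centredHitEnergy≡ = trans (Σ-sumBits-swap N (λ a bs → sq (M * hitCountℤ a bs - + N)))
        (trans (sumBits-ext N Σ-centred-hitCount²)
        (trans (sumBits-+ N (λ bs → (M * M) * hitSquares bs) (λ _ → - (M * (+ N * + N))))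
        (cong₂ _+_ (sumBits-* N (M * M) hitSquares) (sumBits-const N (- (M * (+ N * + N)))))))
      regroup : ∀ M H p K → (M * M) * H + p * - (M * (K * K)) ≡ M * (M * H) + - (M * (p * (K * K)))
      regroup = solve-∀
      collect : ∀ M p K C → M * (p * (K * K + + 33 * C * K)) + - (M * (p * (K * K))) ≡ M * (+ 33 * C * K * p)
      collect = solve-∀

module VarianceSum (m₁ n : ℕ) where

  open import Data.Nat as ℕ using (ℕ; suc; _^_)
  import Data.Nat.Properties as ℕP
  open import Data.Integer as ℤ using (ℤ; +_)
  import Data.Integer.Properties as ℤP
  open import Data.Integer.Tactic.RingSolver using (solve-∀)
  open import Data.Bool using (Bool)
  open import Data.List using (List; []; _∷_; map; upTo; foldr)
  open import Data.Rational as ℚ using (ℚ; toℚᵘ)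
  import Data.Rational.Properties as ℚP
  open import Data.Rational.Unnormalised as ℚᵘ using (ℚᵘ; mkℚᵘ; _≃_; *≡*; *≤*)
  import Data.Rational.Unnormalised.Properties as ℚᵘP
  open import Relation.Binary.PropositionalEquality
  open import Function using (_∘_)
  open import Defs
  open IntegerFacts using (sq; pos-^; *-monoʳ-≤-nonneg; ℕ-nonneg)
  open Sums
  open PeriodicEnergy m₁ using (m; M)
  open PathBounds m₁ using (M³)
  open BitStrings m₁
  open HitCounts m₁

  sumᵘ : ∀ {A : Set} → List A → (A → ℚᵘ) → ℚᵘ
  sumᵘ l f = foldr (λ x acc → f x ℚᵘ.+ acc) ℚᵘ.0ℚᵘ l

  toℚᵘ-sumℚ : ∀ {A : Set} (l : List A) (f : A → ℚ) → toℚᵘ (sumℚ (map f l)) ≃ sumᵘ l (toℚᵘ ∘ f)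
  toℚᵘ-sumℚ [] f = ℚᵘP.≃-refl
  toℚᵘ-sumℚ (x ∷ l) f = ℚᵘP.≃-trans (ℚP.toℚᵘ-homo-+ (f x) (sumℚ (map f l))) (ℚᵘP.+-cong (ℚᵘP.≃-refl {toℚᵘ (f x)}) (toℚᵘ-sumℚ l f))

  +-sameDenominator : ∀ a b d → mkℚᵘ a d ℚᵘ.+ mkℚᵘ b d ≃ mkℚᵘ (a ℤ.+ b) d
  +-sameDenominator a b d = *≡* (trans (collect a b (+ suc d)) (cong ((a ℤ.+ b) ℤ.*_) (sym (ℤP.pos-* (suc d) (suc d)))))
    where
    collect : ∀ a b K → (a ℤ.* K ℤ.+ b ℤ.* K) ℤ.* K ≡ (a ℤ.+ b) ℤ.* (K ℤ.* K)
    collect = solve-∀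

  sumᵘ-sameDenominator : ∀ {A : Set} (l : List A) (F : A → ℚᵘ) (z : A → ℤ) d →
                         (∀ x → F x ≃ mkℚᵘ (z x) d) → sumᵘ l F ≃ mkℚᵘ (sumList l z) d
  sumᵘ-sameDenominator [] F z d eq = *≡* refl
  sumᵘ-sameDenominator (x ∷ l) F z d eq =
    ℚᵘP.≃-trans (ℚᵘP.+-cong (eq x) (sumᵘ-sameDenominator l F z d eq)) (+-sameDenominator (z x) (sumList l z) d)

  -- mkℚᵘ p d denotes p / (d + 1).
  D : ℕ
  D = ℕ.pred ((N n ℕ.* m) ℕ.* (N n ℕ.* m))

  module _ (a : ℕ) (bs : List Bool) where

    d : ℚ
    d = Φrand (N n) m a bs ℚ.- (+ 1) ℚ./ m

    d≃ : toℚᵘ d ≃ mkℚᵘ (hitCountℤ n a bs) n ℚᵘ.+ ℚᵘ.- (mkℚᵘ (+ 1) m₁)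
    d≃ = ℚᵘP.≃-trans (ℚP.toℚᵘ-homo-+ (Φrand (N n) m a bs) (ℚ.- ((+ 1) ℚ./ m)))
      (ℚᵘP.+-cong (ℚP.toℚᵘ-fromℚᵘ (mkℚᵘ (hitCountℤ n a bs) n))
        (ℚᵘP.≃-trans (ℚP.toℚᵘ-homo‿- ((+ 1) ℚ./ m)) (ℚᵘP.-‿cong (ℚP.toℚᵘ-fromℚᵘ (mkℚᵘ (+ 1) m₁)))))

    d²≃ : toℚᵘ (d ℚ.* d) ≃ mkℚᵘ (sq (M ℤ.* hitCountℤ n a bs ℤ.- + N n)) D
    d²≃ = ℚᵘP.≃-trans (ℚP.toℚᵘ-homo-* d d) (ℚᵘP.≃-trans (ℚᵘP.*-cong d≃ d≃)
      (*≡* (cong (λ z → z ℤ.* + ((N n ℕ.* m) ℕ.* (N n ℕ.* m))) (cong sq (collect (hitCountℤ n a bs) M (+ N n))))))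
      where
      collect : ∀ h M K → h ℤ.* M ℤ.+ ℤ.- (+ 1) ℤ.* K ≡ M ℤ.* h ℤ.- K
      collect = solve-∀

  2^N-1 : ℕ
  2^N-1 = ℕ.pred (2 ^ N n)

  suc-2^N-1 : suc 2^N-1 ≡ 2 ^ N n
  suc-2^N-1 = ℕP.suc-pred (2 ^ N n) {{ℕP.m^n≢0 2 (N n)}}

  weight≃ : toℚᵘ (ℚ._/_ (+ 1) (2 ^ N n) {{ℕP.m^n≢0 2 (N n)}}) ≃ mkℚᵘ (+ 1) 2^N-1
  weight≃ = ℚᵘP.≃-trans
    (ℚᵘP.≃-reflexive (cong toℚᵘ (ℚP./-cong {+ 1} {2 ^ N n} {+ 1} {suc 2^N-1} {{ℕP.m^n≢0 2 (N n)}} {{_}} refl (sym suc-2^N-1))))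
    (ℚP.toℚᵘ-fromℚᵘ (mkℚᵘ (+ 1) 2^N-1))

  centredSquares : ℕ → ℤ
  centredSquares a = sumList (allBits (N n)) (λ bs → sq (M ℤ.* hitCountℤ n a bs ℤ.- + N n))

  D′ : ℕ
  D′ = ℕ.pred (suc D ℕ.* suc 2^N-1)

  expectation≃ : ∀ a → toℚᵘ (𝔼 (N n) (λ bs → d a bs ℚ.* d a bs)) ≃ mkℚᵘ (centredSquares a ℤ.* + 1) D′
  expectation≃ a = ℚᵘP.≃-trans (ℚP.toℚᵘ-homo-* (sumℚ (map (λ bs → d a bs ℚ.* d a bs) (allBits (N n)))) _)
    (ℚᵘP.*-cong (ℚᵘP.≃-trans (toℚᵘ-sumℚ (allBits (N n)) (λ bs → d a bs ℚ.* d a bs))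
                             (sumᵘ-sameDenominator (allBits (N n)) _ (λ bs → sq (M ℤ.* hitCountℤ n a bs ℤ.- + N n)) D (d²≃ a)))
                weight≃)

  numerator : ℤ
  numerator = sumList (upTo m) (λ a → centredSquares a ℤ.* + 1)

  varianceSum≃ : toℚᵘ (varianceSum (N n) m) ≃ mkℚᵘ numerator D′
  varianceSum≃ = ℚᵘP.≃-trans (toℚᵘ-sumℚ (upTo m) (λ a → 𝔼 (N n) (λ bs → d a bs ℚ.* d a bs)))
    (sumᵘ-sameDenominator (upTo m) _ (λ a → centredSquares a ℤ.* + 1) D′ expectation≃)

  numerator≡ : numerator ≡ centredHitEnergy n
  numerator≡ = trans (sumList-applyUpTo (λ x → x) m (λ a → centredSquares a ℤ.* + 1))
    (sumTo-ext m (λ a → trans (ℤP.*-identityʳ (centredSquares a)) (sumList-allBits (N n) (λ bs → sq (M ℤ.* hitCountℤ n a bs ℤ.- + N n)))))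

  suc-D′≡ : + (33 ℕ.* (m ℕ.* m)) ℤ.* + suc D′ ≡ (+ 33 ℤ.* (M ℤ.* M)) ℤ.* (((+ N n ℤ.* M) ℤ.* (+ N n ℤ.* M)) ℤ.* (+ 2) ℤ.^ N n)
  suc-D′≡ = cong₂ ℤ._*_ (trans (ℤP.pos-* 33 (m ℕ.* m)) (cong (+ 33 ℤ.*_) (ℤP.pos-* m m)))
    (trans (ℤP.pos-* ((N n ℕ.* m) ℕ.* (N n ℕ.* m)) (suc 2^N-1))
      (cong₂ ℤ._*_ (trans (ℤP.pos-* (N n ℕ.* m) (N n ℕ.* m)) (cong₂ ℤ._*_ (ℤP.pos-* (N n) m) (ℤP.pos-* (N n) m)))
                   (trans (cong +_ suc-2^N-1) (pos-^ 2 (N n)))))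

  varianceSum-≤ : varianceSum (N n) m ℚ.≤ (+ (33 ℕ.* (m ℕ.* m))) ℚ./ N n
  varianceSum-≤ = ℚP.toℚᵘ-cancel-≤ (ℚᵘP.≤-respˡ-≃ (ℚᵘP.≃-sym varianceSum≃)
    (ℚᵘP.≤-respʳ-≃ (ℚᵘP.≃-sym (ℚP.toℚᵘ-fromℚᵘ (mkℚᵘ (+ (33 ℕ.* (m ℕ.* m))) n))) (*≤* cross-multiplied)))
    where
    collect : ∀ M K P → (M ℤ.* (+ 33 ℤ.* (M ℤ.* (M ℤ.* M)) ℤ.* K ℤ.* P)) ℤ.* K ≡ (+ 33 ℤ.* (M ℤ.* M)) ℤ.* (((K ℤ.* M) ℤ.* (K ℤ.* M)) ℤ.* P)
    collect = solve-∀
    cross-multiplied : numerator ℤ.* + N n ℤ.≤ + (33 ℕ.* (m ℕ.* m)) ℤ.* + suc D′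
    cross-multiplied = subst₂ ℤ._≤_ (cong (ℤ._* + N n) (sym numerator≡)) (trans (collect M (+ N n) ((+ 2) ℤ.^ N n)) (sym suc-D′≡))
      (*-monoʳ-≤-nonneg (ℕ-nonneg (N n)) (centredHitEnergy-≤ n))


open import Defs
open import Data.Nat as ℕ using (ℕ; NonZero)
open import Data.Product using (∃; _,_)
open import Data.Integer using (+_)
open import Data.Rational using (_≤_; _/_)

proposition3p3 : ∃ λ (C : ℕ) → (m : ℕ) .{{_ : NonZero m}} → 2 ℕ.≤ m →
    (N : ℕ) .{{_ : NonZero N}} → m ℕ.* m ℕ.≤ N →
    varianceSum N m ≤ (+ (C ℕ.* (m ℕ.* m))) / N
proposition3p3 = 33 , bound
  where
  bound : (m : ℕ) .{{_ : NonZero m}} → 2 ℕ.≤ m → (N : ℕ) .{{_ : NonZero N}} → m ℕ.* m ℕ.≤ N →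
          varianceSum N m ≤ (+ (33 ℕ.* (m ℕ.* m))) / N
  bound (ℕ.suc m₁) _ (ℕ.suc n) _ = VarianceSum.varianceSum-≤ m₁ n
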